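{- Let $\Gamma$ be a maximal $\mathbb{SKHM}$-consistent set and $\mathcal{M}^c_\Gamma=(S^c,R^c,V^c)$ its canonical model. For every formula $\phi$ and every $w\in S^c$: $\mathcal{M}^c_\Gamma,w\vDash\phi$ if and only if $\phi\in L(w)$.
   Context: Formulas over a countable set $\mathbf{P}$ of proposition letters: $\phi::=p\mid\neg\phi\mid(\phi\wedge\phi)\mid \mathcal{K}hm(\phi,\phi,\phi)$; $\top,\bot,\vee,\to$ usual abbreviations; $\mathcal{U}\phi$ abbreviates $\mathcal{K}hm(\neg\phi,\top,\bot)$. The system $\mathbb{SKHM}$ (with $p,q,r,o,p',q',o'$ proposition letters) has axioms: TAUT all propositional tautologies; DISTU $\mathcal{U}p\wedge\mathcal{U}(p\to q)\to\mathcal{U}q$; TU $\mathcal{U}p\to p$; 4KhmU $\mathcal{K}hm(p,o,q)\to\mathcal{U}\mathcal{K}hm(p,o,q)$; 5KhmU $\neg\mathcal{K}hm(p,o,q)\to\mathcal{U}\neg\mathcal{K}hm(p,o,q)$; EMPKhm $\mathcal{U}(p\to q)\to\mathcal{K}hm(p,\bot,q)$; COMPKhm $\mathcal{K}hm(p,o,r)\wedge\mathcal{K}hm(r,o,q)\wedge\mathcal{U}(r\to o)\to\mathcal{K}hm(p,o,q)$; ONEKhm $\mathcal{K}hm(p,o,q)\wedge\neg\mathcal{K}hm(p,\bot,q)\to\mathcal{K}hm(p,\bot,o)$; UKhm $\mathcal{U}(p'\to p)\wedge\mathcal{U}(o\to o')\wedge\mathcal{U}(q\to q')\wedge\mathcal{K}hm(p,o,q)\to\mathcal{K}hm(p',o',q')$;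 rules MP, NECU, SUB. Models and semantics: a model $(S,R,V)$ has $S\ne\emptyset$, $R$ assigning to each action symbol a binary relation on $S$, $V:S\to2^{\mathbf{P}}$; $s\xrightarrow{\sigma}t$ for $\sigma=a_1\cdots a_n$ means a path labelled $a_1,\dots,a_n$ ($s\xrightarrow{\epsilon}s$); $\sigma_k=a_1\cdots a_k$; $\sigma$ is strongly $\chi$-executable at $s'$ if for each $0\le k<n$ every $t$ with $s'\xrightarrow{\sigma_k}t$ has an $a_{k+1}$-successor and $s'\xrightarrow{\sigma_k}t$ implies $t\vDash\chi$ for $0<k<n$; $s\vDash\mathcal{K}hm(\psi,\chi,\phi)$ iff some sequence $\sigma$ of actions is strongly $\chi$-executable at every $\psi$-state $s'$ and all $t$ with $s'\xrightarrow{\sigma}t$ satisfy $\phi$; Boolean and atomic clauses as usual. Canonical model: $\Phi_\Gamma$ is the set of maximal consistent $\Delta$ containing exactly the same $\mathcal{K}hm$-formulas as $\Gamma$. Action symbols $\Sigma_\Gamma=\{\langle\psi,\bot,\phi\rangle\mid\mathcal{K}hm(\psi,\bot,\phi)\in\Gamma\}\cup\{\langle\chi^\psi,\phi\rangle\mid\mathcal{K}hm(\psi,\chi,\phi)\in\Gamma,\ \neg\mathcal{K}hm(\psi,\bot,\phi)\in\Gamma\}$ (formal symbols built from formulas; $\chi^\psi$ is a formal marker pairing formulas $\chi,\psi$). $S^c$ is the set of pairs $w=(\Delta,\chi^\psi)$ with $\chi\in\Delta\in\Phi_\Gamma$ such that $\langle\chi^\psi,\phi\rangle\in\Sigma_\Gamma$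 for some $\phi$ or $\langle\psi,\bot,\chi\rangle\in\Sigma_\Gamma$; write $L(w)=\Delta$, $R(w)=\chi^\psi$. Transitions: $w\xrightarrow{\langle\psi,\bot,\phi\rangle}w'$ iff $\psi\in L(w)$ and $R(w')=\phi^\psi$; $w\xrightarrow{\langle\chi^\psi,\phi\rangle}w'$ iff $R(w)=\chi^\psi$ and $\phi\in L(w')$. Valuation: $p\in V^c(w)$ iff $p\in L(w)$. -}

module Defs where

open import Data.Nat using (ℕ; zero; suc; _<_)
open import Data.Bool using (Bool; true; false)
open import Data.List using (List; []; _∷_; length; take; lookup)
open import Data.List.Relation.Unary.All using (All)
open import Data.Fin using (fromℕ<)
open import Data.Product using (Σ; ∃; _×_; _,_)
open import Data.Sum using (_⊎_)
open import Relation.Nullary using (¬_)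
open import Relation.Binary.PropositionalEquality using (_≡_)

infixr 6 _∧_
infix  7 ~_

data Formula : Set where
  atom : ℕ → Formula
  ~_   : Formula → Formula
  _∧_  : Formula → Formula → Formula
  Khm  : Formula → Formula → Formula → Formula

⊥f : Formula
⊥f = atom 0 ∧ ~ atom 0

⊤f : Formula
⊤f = ~ ⊥f

infixr 5 _⇒_
_⇒_ : Formula → Formula → Formula
φ ⇒ ψ = ~ (φ ∧ ~ ψ)

U : Formula → Formula
U φ = Khm (~ φ) ⊤f ⊥f

-- Propositional tautologies: true under every classical evaluation that
-- treats atoms and Khm-formulas as propositional variables.

eval : (Formula → Bool) → Formula → Bool
eval v (atom n) = v (atom n)
eval v (~ φ) with eval v φ
... | true = false
... | false = true
eval v (φ ∧ ψ) with eval v φ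
... | true = eval v ψ
... | false = false
eval v (Khm ψ χ φ) = v (Khm ψ χ φ)

Taut : Formula → Set
Taut φ = ∀ (v : Formula → Bool) → eval v φ ≡ true

subst : (ℕ → Formula) → Formula → Formula
subst θ (atom n) = θ n
subst θ (~ φ) = ~ subst θ φ
subst θ (φ ∧ ψ) = subst θ φ ∧ subst θ ψ
subst θ (Khm ψ χ φ) = Khm (subst θ ψ) (subst θ χ) (subst θ φ)

p q r o p' q' o' : Formula
p = atom 0
q = atom 1
r = atom 2
o = atom 3
p' = atom 4
q' = atom 5
o' = atom 6

data Axiom : Formula → Set where
  DISTU   : Axiom ((U p ∧ U (p ⇒ q)) ⇒ U q)
  TU      : Axiom (U p ⇒ p)
  4KhmU   : Axiom (Khm p o q ⇒ U (Khm p o q))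
  5KhmU   : Axiom (~ Khm p o q ⇒ U (~ Khm p o q))
  EMPKhm  : Axiom (U (p ⇒ q) ⇒ Khm p ⊥f q)
  COMPKhm : Axiom ((Khm p o r ∧ Khm r o q ∧ U (r ⇒ o)) ⇒ Khm p o q)
  ONEKhm  : Axiom ((Khm p o q ∧ ~ Khm p ⊥f q) ⇒ Khm p ⊥f o)
  UKhm    : Axiom ((U (p' ⇒ p) ∧ U (o ⇒ o') ∧ U (q ⇒ q') ∧ Khm p o q)
                   ⇒ Khm p' o' q')

infix 3 ⊢_
data ⊢_ : Formula → Set where
  taut : ∀ {φ} → Taut φ → ⊢ φ
  ax   : ∀ {φ} → Axiom φ → ⊢ φ
  MP   : ∀ {φ ψ} → ⊢ φ → ⊢ (φ ⇒ ψ) → ⊢ ψ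
  NECU : ∀ {φ} → ⊢ φ → ⊢ U φ
  SUB  : ∀ {φ} (θ : ℕ → Formula) → ⊢ φ → ⊢ subst θ φ

conj : List Formula → Formula
conj [] = ⊤f
conj (φ ∷ l) = φ ∧ conj l

Consistent : (Formula → Set) → Set
Consistent P = ¬ (Σ (List Formula) λ l → All P l × (⊢ ~ conj l))

-- sets of formulas (classical subsets, as characteristic functions)
FSet : Set
FSet = Formula → Bool

infix 4 _∈_
_∈_ : Formula → FSet → Set
φ ∈ Δ = Δ φ ≡ true

MCS : FSet → Set
MCS Δ = Consistent (λ ψ → ψ ∈ Δ)
      × (∀ φ → Δ φ ≡ false → ¬ Consistent (λ ψ → ψ ∈ Δ ⊎ ψ ≡ φ))

record Model : Set₁ where
  field
    Act : Set
    S   : Set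
    Rel : Act → S → S → Set
    Val : S → ℕ → Bool

module Semantics (M : Model) where
  open Model M

  data Path : List Act → S → S → Set where
    nil  : ∀ {s} → Path [] s s
    cons : ∀ {a σ s u t} → Rel a s u → Path σ u t → Path (a ∷ σ) s t

  StrongExec : (S → Set) → List Act → S → Set
  StrongExec X σ s' =
    ∀ k → (k<n : k < length σ) → ∀ t → Path (take k σ) s' t →
      (∃ λ u → Rel (lookup σ (fromℕ< k<n)) t u) × (0 < k → X t)

  infix 4 _⊨_
  _⊨_ : S → Formula → Set
  s ⊨ atom n = Val s n ≡ true
  s ⊨ ~ φ = ¬ (s ⊨ φ)
  s ⊨ (φ ∧ ψ) = (s ⊨ φ) × (s ⊨ ψ)
  s ⊨ Khm ψ χ φ =
    ∃ λ (σ : List Act) → ∀ s' → s' ⊨ ψ →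
      StrongExec (λ t → t ⊨ χ) σ s' × (∀ t → Path σ s' t → t ⊨ φ)

-- formal action symbols: emp ψ φ = ⟨ψ,⊥,φ⟩ ; mrk χ ψ φ = ⟨χ^ψ,φ⟩
data ActSym : Set where
  emp : Formula → Formula → ActSym
  mrk : Formula → Formula → Formula → ActSym

InΣ : FSet → ActSym → Set
InΣ Γ (emp ψ φ) = Khm ψ ⊥f φ ∈ Γ
InΣ Γ (mrk χ ψ φ) = (Khm ψ χ φ ∈ Γ) × (~ Khm ψ ⊥f φ ∈ Γ)

ΣΓ : FSet → Set
ΣΓ Γ = Σ ActSym (InΣ Γ)

-- states w = (Δ, χ^ψ); L w = Δ, R w = χ^ψ given by (mχ w , mψ w)
record CState (Γ : FSet) : Set where
  field
    L    : FSet
    mcs  : MCS L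
    same : ∀ ψ χ φ → L (Khm ψ χ φ) ≡ Γ (Khm ψ χ φ)
    mχ   : Formula
    mψ   : Formula
    χ∈L  : mχ ∈ L
    ok   : (∃ λ φ → InΣ Γ (mrk mχ mψ φ)) ⊎ InΣ Γ (emp mψ mχ)
open CState public

CRel : (Γ : FSet) → ΣΓ Γ → CState Γ → CState Γ → Set
CRel Γ (emp ψ φ , _) w w' = (ψ ∈ L w) × ((mχ w' ≡ φ) × (mψ w' ≡ ψ))
CRel Γ (mrk χ ψ φ , _) w w' = ((mχ w ≡ χ) × (mψ w ≡ ψ)) × (φ ∈ L w')

CanModel : FSet → Model
CanModel Γ = record
  { Act = ΣΓ Γ
  ; S   = CState Γ
  ; Rel = CRel Γ
  ; Val = λ w n → L w (atom n)
  }

_,_⊨c_ : (Γ : FSet) → CState Γ → Formula → Set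
Γ , w ⊨c φ = Semantics._⊨_ (CanModel Γ) w φ

module Submission where

-- A plan that
--     works from all θ-states is turned into Khm θ χ φ ∈ Γ by induction on the
--     plan (COMPKhm glues the steps), and conversely Khm ψ χ φ ∈ Γ is witnessed
--     by the plan ⟨ψ,⊥,φ⟩, or ⟨ψ,⊥,χ⟩⟨χ^ψ,φ⟩ using ONEKhm.

open import Defs
open import Function using (id; _∘_)
open import Function.Bundles using (_⇔_; mk⇔; Equivalence)
open import Relation.Binary.PropositionalEquality
  using (_≡_; refl; sym; trans; cong; cong₂; subst₂) renaming (subst to ≡-subst)
open import Data.Nat using (ℕ; zero; suc; _≤_; _≤′_; _⊔_; z≤n; s≤s; ≤′-refl; ≤′-step)
open import Data.Nat.Properties using (≤⇒≤′; m⊔n≤o⇒m≤o; m⊔n≤o⇒n≤o; ≤-refl)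
open import Data.Bool using (Bool; true; false; not; T) renaming (_∧_ to _&&_)
open import Data.Bool.Properties using (T-≡; T-∧)
open import Data.Fin using (Fin) renaming (zero to fz; suc to fs)
open import Data.Vec using (Vec; []; _∷_; lookup; map)
open import Data.Vec.Properties using (lookup-map)
open import Data.List using (List; []; _∷_; _++_)
open import Data.List.Relation.Unary.All using (All; []; _∷_)
open import Data.List.Relation.Unary.All.Properties using (++⁺)
open import Data.Product using (Σ; ∃; _×_; _,_; proj₁; proj₂)
open import Data.Sum using (_⊎_; inj₁; inj₂)
import Data.Sum as Sum
open import Data.Unit using (⊤; tt)
open import Data.Empty using (⊥; ⊥-elim)
open import Relation.Nullary using (¬_)

-- Propositional schemes in n metavariables.  A scheme whose truth table is
-- constantly true instantiates to a derivable formula (axiom TAUT).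

infixr 4 _⊃_
infixr 5 _&_
infix  6 !_

data Scheme (n : ℕ) : Set where
  var : Fin n → Scheme n
  !_  : Scheme n → Scheme n
  _&_ : Scheme n → Scheme n → Scheme n

_⊃_ : ∀ {n} → Scheme n → Scheme n → Scheme n
a ⊃ b = ! (a & ! b)

⊥ˢ ⊤ˢ : ∀ {n} → Scheme n → Scheme n
⊥ˢ a = a & ! a
⊤ˢ a = ! ⊥ˢ a

x₀ : ∀ {n} → Scheme (suc n)
x₀ = var fz
x₁ : ∀ {n} → Scheme (suc (suc n))
x₁ = var (fs fz)
x₂ : ∀ {n} → Scheme (suc (suc (suc n)))
x₂ = var (fs (fs fz))
x₃ : ∀ {n} → Scheme (suc (suc (suc (suc n))))
x₃ = var (fs (fs (fs fz)))

_⟦_⟧ : ∀ {n} → Scheme n → Vec Formula n → Formula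
var i ⟦ ρ ⟧ = lookup ρ i
(! a) ⟦ ρ ⟧ = ~ (a ⟦ ρ ⟧)
(a & b) ⟦ ρ ⟧ = a ⟦ ρ ⟧ ∧ b ⟦ ρ ⟧

truth : ∀ {n} → Scheme n → Vec Bool n → Bool
truth (var i) β = lookup β i
truth (! a) β = not (truth a β)
truth (a & b) β = truth a β && truth b β

valid : (n : ℕ) → (Vec Bool n → Bool) → Bool
valid zero g = g []
valid (suc n) g = valid n (λ β → g (true ∷ β)) && valid n (λ β → g (false ∷ β))

valid-sound : ∀ n g → T (valid n g) → ∀ β → T (g β)
valid-sound zero g ok [] = ok
valid-sound (suc n) g ok (true ∷ β) = valid-sound n _ (proj₁ (Equivalence.to T-∧ ok)) β
valid-sound (suc n) g ok (false ∷ β) = valid-sound n _ (proj₂ (Equivalence.to T-∧ ok)) β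

eval-~ : ∀ v φ → eval v (~ φ) ≡ not (eval v φ)
eval-~ v φ with eval v φ
... | true = refl
... | false = refl

eval-∧ : ∀ v φ ψ → eval v (φ ∧ ψ) ≡ (eval v φ && eval v ψ)
eval-∧ v φ ψ with eval v φ
... | true = refl
... | false = refl

eval-instance : ∀ {n} v (a : Scheme n) ρ → eval v (a ⟦ ρ ⟧) ≡ truth a (map (eval v) ρ)
eval-instance v (var i) ρ = sym (lookup-map i (eval v) ρ)
eval-instance v (! a) ρ = trans (eval-~ v (a ⟦ ρ ⟧)) (cong not (eval-instance v a ρ))
eval-instance v (a & b) ρ =
  trans (eval-∧ v (a ⟦ ρ ⟧) (b ⟦ ρ ⟧)) (cong₂ _&&_ (eval-instance v a ρ) (eval-instance v b ρ))

instance-taut : ∀ {n} (a : Scheme n) → T (valid n (truth a)) → ∀ ρ → Taut (a ⟦ ρ ⟧)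
instance-taut {n} a ok ρ v =
  trans (eval-instance v a ρ) (Equivalence.to T-≡ (valid-sound n (truth a) ok (map (eval v) ρ)))

-- The validity proof is an implicit argument of type ⊤ once the table has been
-- computed, so Agda fills it in for every concrete valid scheme.
tautology : ∀ {n} (a : Scheme n) {ok : T (valid n (truth a))} (ρ : Vec Formula n) → ⊢ a ⟦ ρ ⟧
tautology a {ok} ρ = taut (instance-taut a ok ρ)

syllogism : ∀ {a b c} → ⊢ a ⇒ b → ⊢ b ⇒ c → ⊢ a ⇒ c
syllogism {a} {b} {c} ab bc = MP bc (MP ab (tautology ((x₀ ⊃ x₁) ⊃ (x₁ ⊃ x₂) ⊃ (x₀ ⊃ x₂)) (a ∷ b ∷ c ∷ [])))

-- substitution sending the i-th proposition letter to the i-th formula of a list;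
-- with it, SUB instantiates the axioms (letters p q r o p' q' o' are 0 … 6)
letters : List Formula → ℕ → Formula
letters [] _ = atom 0
letters (φ ∷ φs) zero = φ
letters (φ ∷ φs) (suc n) = letters φs n

conj-++ : ∀ l m → ⊢ conj (l ++ m) ⇒ (conj l ∧ conj m)
conj-++ [] m = tautology (x₀ ⊃ (⊤ˢ x₁ & x₀)) (conj m ∷ atom 0 ∷ [])
conj-++ (φ ∷ l) m = MP (conj-++ l m)
  (tautology ((x₀ ⊃ (x₁ & x₂)) ⊃ ((x₃ & x₀) ⊃ ((x₃ & x₁) & x₂))) (conj (l ++ m) ∷ conj l ∷ conj m ∷ φ ∷ []))

module MaxConsistent (Δ : FSet) (mcs : MCS Δ) where

  Within : List Formula → Set
  Within = All (_∈ Δ)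

  consistent : ∀ l → Within l → ¬ (⊢ ~ conj l)
  consistent l l⊆Δ ⊢¬l = proj₁ mcs (l , l⊆Δ , ⊢¬l)

  separate : ∀ β l → All (λ ψ → ψ ∈ Δ ⊎ ψ ≡ β) l →
    Σ (List Formula) λ l' → Within l' × (⊢ (β ∧ conj l') ⇒ conj l)
  separate β [] [] = [] , [] , tautology ((x₀ & x₁) ⊃ x₁) (β ∷ ⊤f ∷ [])
  separate β (φ ∷ l) (inj₁ φ∈Δ ∷ rest) with separate β l rest
  ... | l' , l'⊆Δ , ⊢l = φ ∷ l' , φ∈Δ ∷ l'⊆Δ ,
    MP ⊢l (tautology (((x₀ & x₁) ⊃ x₂) ⊃ ((x₀ & (x₃ & x₁)) ⊃ (x₃ & x₂))) (β ∷ conj l' ∷ conj l ∷ φ ∷ []))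
  separate β (.β ∷ l) (inj₂ refl ∷ rest) with separate β l rest
  ... | l' , l'⊆Δ , ⊢l = l' , l'⊆Δ ,
    MP ⊢l (tautology (((x₀ & x₁) ⊃ x₂) ⊃ ((x₀ & x₁) ⊃ (x₀ & x₂))) (β ∷ conj l' ∷ conj l ∷ []))

  ∈-if-unrefuted : ∀ β → (∀ l → Within l → ¬ (⊢ ~ (β ∧ conj l))) → β ∈ Δ
  ∈-if-unrefuted β unrefuted with Δ β in β∉Δ
  ... | true = refl
  ... | false = ⊥-elim (proj₂ mcs β β∉Δ λ (l , l⊆Δβ , ⊢¬l) →
    let (l' , l'⊆Δ , ⊢l) = separate β l l⊆Δβ in
    unrefuted l' l'⊆Δ (MP ⊢¬l (MP ⊢l (tautology ((x₀ ⊃ x₁) ⊃ (! x₁ ⊃ ! x₀)) ((β ∧ conj l') ∷ conj l ∷ [])))))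

  theorem∈ : ∀ {β} → ⊢ β → β ∈ Δ
  theorem∈ {β} ⊢β = ∈-if-unrefuted β λ l l⊆Δ ⊢¬βl →
    consistent l l⊆Δ (MP ⊢β (MP ⊢¬βl (tautology (! (x₀ & x₁) ⊃ (x₀ ⊃ ! x₁)) (β ∷ conj l ∷ []))))

  mp∈ : ∀ {a b} → a ∈ Δ → (a ⇒ b) ∈ Δ → b ∈ Δ
  mp∈ {a} {b} a∈Δ ab∈Δ = ∈-if-unrefuted b λ l l⊆Δ ⊢¬bl →
    consistent (a ∷ (a ⇒ b) ∷ l) (a∈Δ ∷ ab∈Δ ∷ l⊆Δ)
      (MP ⊢¬bl (tautology (! (x₀ & x₁) ⊃ ! (x₂ & ((x₂ ⊃ x₀) & x₁))) (b ∷ conj l ∷ a ∷ [])))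

  not-both : ∀ {β} → β ∈ Δ → (~ β) ∈ Δ → ⊥
  not-both {β} β∈Δ ¬β∈Δ = consistent (β ∷ ~ β ∷ []) (β∈Δ ∷ ¬β∈Δ ∷ [])
    (tautology (! (x₀ & (! x₀ & x₁))) (β ∷ ⊤f ∷ []))

  -- negation completeness: if parts l₁, l₂ of Δ refuted β and ¬β, then l₁ ++ l₂ would refute ⊤
  neg∈ : ∀ {β} → Δ β ≡ false → (~ β) ∈ Δ
  neg∈ {β} β∉Δ = ∈-if-unrefuted (~ β) λ l₂ l₂⊆Δ ⊢¬¬βl₂ →
    proj₂ mcs β β∉Δ λ (l , l⊆Δβ , ⊢¬l) →
    let (l₁ , l₁⊆Δ , ⊢l) = separate β l l⊆Δβ
        ⊢¬βl₁ = MP ⊢¬l (MP ⊢l (tautology ((x₀ ⊃ x₁) ⊃ (! x₁ ⊃ ! x₀)) ((β ∧ conj l₁) ∷ conj l ∷ [])))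
    in consistent (l₁ ++ l₂) (++⁺ l₁⊆Δ l₂⊆Δ)
         (MP (conj-++ l₁ l₂) (MP ⊢¬¬βl₂ (MP ⊢¬βl₁
           (tautology (! (x₀ & x₁) ⊃ (! (! x₀ & x₂) ⊃ ((x₃ ⊃ (x₁ & x₂)) ⊃ ! x₃)))
                      (β ∷ conj l₁ ∷ conj l₂ ∷ conj (l₁ ++ l₂) ∷ [])))))

  decide : ∀ β → β ∈ Δ ⊎ (~ β) ∈ Δ
  decide β with Δ β in eq
  ... | true = inj₁ refl
  ... | false = inj₂ (neg∈ eq)

  ∉-backwards : ∀ {a b} → (a ∈ Δ → b ∈ Δ) → Δ b ≡ false → Δ a ≡ false
  ∉-backwards {a} a→b b∉Δ with Δ a
  ... | false = refl
  ... | true = trans (sym (a→b refl)) b∉Δ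

  imp∈ : ∀ {a b} → ⊢ a ⇒ b → a ∈ Δ → b ∈ Δ
  imp∈ ⊢ab a∈Δ = mp∈ a∈Δ (theorem∈ ⊢ab)

  imp₂∈ : ∀ {a b c} → ⊢ a ⇒ (b ⇒ c) → a ∈ Δ → b ∈ Δ → c ∈ Δ
  imp₂∈ ⊢abc a∈Δ b∈Δ = mp∈ b∈Δ (imp∈ ⊢abc a∈Δ)

  ∧-elimˡ : ∀ {a b} → (a ∧ b) ∈ Δ → a ∈ Δ
  ∧-elimˡ {a} {b} = imp∈ (tautology ((x₀ & x₁) ⊃ x₀) (a ∷ b ∷ []))

  ∧-elimʳ : ∀ {a b} → (a ∧ b) ∈ Δ → b ∈ Δ
  ∧-elimʳ {a} {b} = imp∈ (tautology ((x₀ & x₁) ⊃ x₁) (a ∷ b ∷ []))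

  ∧-intro : ∀ {a b} → a ∈ Δ → b ∈ Δ → (a ∧ b) ∈ Δ
  ∧-intro {a} {b} = imp₂∈ (tautology (x₀ ⊃ (x₁ ⊃ (x₀ & x₁))) (a ∷ b ∷ []))

-- U γ written with verum and falsum built on the formula b instead of atom 0;
-- substituting b for the letter p turns the U-subformulas of an axiom into this form.
U[_] : Formula → Formula → Formula
U[ b ] γ = Khm (~ γ) (~ (b ∧ ~ b)) (b ∧ ~ b)

-- The SKHM axioms and rules read as closure properties of a maximal consistent set.
-- Each axiom enters through SUB, choosing the formulas for its letters via `letters`.
module KhmTheory (Δ : FSet) (mcs : MCS Δ) where
  open MaxConsistent Δ mcs public

  -- the choice of b in U[ b ] is immaterial (an instance of UKhm)
  U-rebase : ∀ b c γ → U[ b ] γ ∈ Δ → U[ c ] γ ∈ Δ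
  U-rebase b c γ h = mp∈ (∧-intro (theorem∈ same-ante) (∧-intro (theorem∈ same-top) (∧-intro (theorem∈ same-bot) h)))
    (theorem∈ (SUB (letters (~ γ ∷ (b ∧ ~ b) ∷ ~ γ ∷ ~ (b ∧ ~ b) ∷ ~ γ ∷ (c ∧ ~ c) ∷ ~ (c ∧ ~ c) ∷ [])) (ax UKhm)))
    where
    same-ante : ⊢ U[ ~ γ ] (~ γ ⇒ ~ γ)
    same-ante = SUB (letters (~ γ ∷ ~ γ ∷ [])) (NECU (tautology (x₀ ⊃ x₀) (q ∷ [])))
    same-top : ⊢ U[ ~ γ ] (~ (b ∧ ~ b) ⇒ ~ (c ∧ ~ c))
    same-top = SUB (letters (~ γ ∷ b ∷ c ∷ [])) (NECU (tautology (⊤ˢ x₀ ⊃ ⊤ˢ x₁) (q ∷ r ∷ [])))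
    same-bot : ⊢ U[ ~ γ ] ((b ∧ ~ b) ⇒ (c ∧ ~ c))
    same-bot = SUB (letters (~ γ ∷ b ∷ c ∷ [])) (NECU (tautology (⊥ˢ x₀ ⊃ ⊥ˢ x₁) (q ∷ r ∷ [])))

  U-at : ∀ a {γ} → U γ ∈ Δ → U[ a ] γ ∈ Δ
  U-at a = U-rebase (atom 0) a _

  U-of : ∀ a {γ} → U[ a ] γ ∈ Δ → U γ ∈ Δ
  U-of a = U-rebase a (atom 0) _

  nec∈ : ∀ {γ} → ⊢ γ → U γ ∈ Δ
  nec∈ = theorem∈ ∘ NECU

  U-mp : ∀ {a b} → U a ∈ Δ → U (a ⇒ b) ∈ Δ → U b ∈ Δ
  U-mp {a} {b} Ua Uab = U-of a (mp∈ (∧-intro (U-at a Ua) (U-at a Uab))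
    (theorem∈ (SUB (letters (a ∷ b ∷ [])) (ax DISTU))))

  U-T : ∀ {a} → U a ∈ Δ → a ∈ Δ
  U-T {a} Ua = mp∈ (U-at a Ua) (theorem∈ (SUB (letters (a ∷ [])) (ax TU)))

  U-mono : ∀ {a b} → ⊢ a ⇒ b → U a ∈ Δ → U b ∈ Δ
  U-mono ⊢ab Ua = U-mp Ua (nec∈ ⊢ab)

  U-mono₂ : ∀ {a b c} → ⊢ a ⇒ (b ⇒ c) → U a ∈ Δ → U b ∈ Δ → U c ∈ Δ
  U-mono₂ ⊢abc Ua Ub = U-mp Ub (U-mono ⊢abc Ua)

  U-refl : ∀ {a} → U (a ⇒ a) ∈ Δ
  U-refl {a} = nec∈ (tautology (x₀ ⊃ x₀) (a ∷ []))

  U-vacuous : ∀ {a b} → U (~ a) ∈ Δ → U (a ⇒ b) ∈ Δ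
  U-vacuous {a} {b} = U-mono (tautology (! x₀ ⊃ (x₀ ⊃ x₁)) (a ∷ b ∷ []))

  U-lift₁ : ∀ {a b c} → ⊢ a ⇒ b → U (c ⇒ a) ∈ Δ → U (c ⇒ b) ∈ Δ
  U-lift₁ {a} {b} {c} ⊢ab = U-mono (MP ⊢ab (tautology ((x₀ ⊃ x₁) ⊃ ((x₂ ⊃ x₀) ⊃ (x₂ ⊃ x₁))) (a ∷ b ∷ c ∷ [])))

  U-lift₂ : ∀ {a b d c} → ⊢ a ⇒ (b ⇒ d) → U (c ⇒ a) ∈ Δ → U (c ⇒ b) ∈ Δ → U (c ⇒ d) ∈ Δ
  U-lift₂ {a} {b} {d} {c} ⊢abd = U-mono₂ (MP ⊢abd
    (tautology ((x₀ ⊃ (x₁ ⊃ x₂)) ⊃ ((x₃ ⊃ x₀) ⊃ ((x₃ ⊃ x₁) ⊃ (x₃ ⊃ x₂)))) (a ∷ b ∷ d ∷ c ∷ [])))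

  Khm-4 : ∀ {a o b} → Khm a o b ∈ Δ → U (Khm a o b) ∈ Δ
  Khm-4 {a} {o} {b} k = U-of a (mp∈ k (theorem∈ (SUB (letters (a ∷ b ∷ a ∷ o ∷ [])) (ax 4KhmU))))

  Khm-5 : ∀ {a o b} → (~ Khm a o b) ∈ Δ → U (~ Khm a o b) ∈ Δ
  Khm-5 {a} {o} {b} k = U-of a (mp∈ k (theorem∈ (SUB (letters (a ∷ b ∷ a ∷ o ∷ [])) (ax 5KhmU))))

  UKhm∈ : ∀ {a a' o o' b b'} → U (a' ⇒ a) ∈ Δ → U (o ⇒ o') ∈ Δ → U (b ⇒ b') ∈ Δ →
    Khm a o b ∈ Δ → Khm a' o' b' ∈ Δ
  UKhm∈ {a} {a'} {o} {o'} {b} {b'} U₁ U₂ U₃ k =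
    mp∈ (∧-intro (U-at a U₁) (∧-intro (U-at a U₂) (∧-intro (U-at a U₃) k)))
        (theorem∈ (SUB (letters (a ∷ b ∷ a ∷ o ∷ a' ∷ b' ∷ o' ∷ [])) (ax UKhm)))

  -- SUB instances of EMPKhm and ONEKhm mention the contradiction c ∧ ¬c instead of ⊥f
  ⊥-rebase : ∀ {a b c} → Khm a (c ∧ ~ c) b ∈ Δ → Khm a ⊥f b ∈ Δ
  ⊥-rebase {c = c} = UKhm∈ U-refl (nec∈ (tautology (⊥ˢ x₀ ⊃ ⊥ˢ x₁) (c ∷ atom 0 ∷ []))) U-refl

  EMP∈ : ∀ {a b} → U (a ⇒ b) ∈ Δ → Khm a ⊥f b ∈ Δ
  EMP∈ {a} {b} Uab = ⊥-rebase (mp∈ (U-at a Uab) (theorem∈ (SUB (letters (a ∷ b ∷ [])) (ax EMPKhm))))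

  COMP∈ : ∀ {a o r b} → Khm a o r ∈ Δ → Khm r o b ∈ Δ → U (r ⇒ o) ∈ Δ → Khm a o b ∈ Δ
  COMP∈ {a} {o} {r} {b} k₁ k₂ Uro =
    mp∈ (∧-intro k₁ (∧-intro k₂ (U-at a Uro))) (theorem∈ (SUB (letters (a ∷ b ∷ r ∷ o ∷ [])) (ax COMPKhm)))

  ONE∈ : ∀ {a o b} → Khm a o b ∈ Δ → (~ Khm a ⊥f b) ∈ Δ → Khm a ⊥f o ∈ Δ
  ONE∈ {a} {o} {b} k ¬k⊥ with decide (Khm a (a ∧ ~ a) b)
  ... | inj₁ k⊥ = ⊥-elim (not-both (⊥-rebase k⊥) ¬k⊥)
  ... | inj₂ ¬k⊥' = ⊥-rebase (mp∈ (∧-intro k ¬k⊥')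
                              (theorem∈ (SUB (letters (a ∷ b ∷ a ∷ o ∷ [])) (ax ONEKhm))))

  Khm-via : ∀ {a m b c} → Khm a ⊥f m ∈ Δ → U (m ⇒ b) ∈ Δ → Khm a c b ∈ Δ
  Khm-via {c = c} k Umb = UKhm∈ U-refl (nec∈ (tautology (⊥ˢ x₀ ⊃ x₁) (atom 0 ∷ c ∷ []))) Umb k

  Khm-widen : ∀ {a b c} → Khm a ⊥f b ∈ Δ → Khm a c b ∈ Δ
  Khm-widen k = Khm-via k U-refl

  Khm-emp : ∀ {a b c} → U (a ⇒ b) ∈ Δ → Khm a c b ∈ Δ
  Khm-emp Uab = Khm-widen (EMP∈ Uab)

  Khm-vacuous : ∀ {a b c} → U (~ a) ∈ Δ → Khm a c b ∈ Δ
  Khm-vacuous = Khm-emp ∘ U-vacuous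

  Khm-impossible-goal : ∀ {a c b} → Khm a c b ∈ Δ → U (~ b) ∈ Δ → U (~ a) ∈ Δ
  Khm-impossible-goal {a} {c} {b} k U¬b =
    UKhm∈ (nec∈ (tautology (! ! x₀ ⊃ x₀) (a ∷ [])))
          (nec∈ (tautology (x₀ ⊃ ⊤ˢ x₁) (c ∷ atom 0 ∷ [])))
          (U-mono (tautology (! x₀ ⊃ (x₀ ⊃ ⊥ˢ x₁)) (b ∷ atom 0 ∷ [])) U¬b) k

letter-bound : Formula → ℕ
letter-bound (atom n) = suc n
letter-bound (~ α) = letter-bound α
letter-bound (α ∧ β) = letter-bound α ⊔ letter-bound β
letter-bound (Khm _ _ _) = 0

signed : Bool → Formula → Formula
signed true α = α
signed false α = ~ α

signed-~ : ∀ b α → ⊢ signed b α ⇒ signed (not b) (~ α)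
signed-~ true α = tautology (x₀ ⊃ ! ! x₀) (α ∷ [])
signed-~ false α = tautology (x₀ ⊃ x₀) (~ α ∷ [])

signed-∧ : ∀ b c α β → ⊢ signed b α ⇒ (signed c β ⇒ signed (b && c) (α ∧ β))
signed-∧ true true α β = tautology (x₀ ⊃ (x₁ ⊃ (x₀ & x₁))) (α ∷ β ∷ [])
signed-∧ true false α β = tautology (x₀ ⊃ (! x₁ ⊃ ! (x₀ & x₁))) (α ∷ β ∷ [])
signed-∧ false c α β = tautology (! x₀ ⊃ (x₂ ⊃ ! (x₀ & x₁))) (α ∷ β ∷ signed c β ∷ [])

-- Given U¬θ ∉ Γ, the classical valuation below makes θ true,
-- agrees with Γ on Khm-formulas and fixes the letters n = 0, 1, … so that the
-- approximation θ ∧ ℓ₀ ∧ … ∧ ℓₙ₋₁ stays possible.  Every formula true under it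
-- is then U-implied by a possible approximation, which makes its set of true
-- formulas consistent.
module Extension (Γ : FSet) (mΓ : MCS Γ) (θ : Formula) (θ-possible : Γ (U (~ θ)) ≡ false) where
  open KhmTheory Γ mΓ

  mutual
    approx : ℕ → Formula
    approx zero = θ
    approx (suc n) = approx n ∧ signed (valuation (atom n)) (atom n)

    valuation : Formula → Bool
    valuation (atom n) = not (Γ (U (~ (approx n ∧ atom n))))
    valuation (Khm a c b) = Γ (Khm a c b)
    valuation _ = false

  Δ : FSet
  Δ = eval valuation

  approx-possible : ∀ n → Γ (U (~ approx n)) ≡ false
  approx-possible zero = θ-possible
  approx-possible (suc n) with Γ (U (~ (approx n ∧ atom n))) in atom-impossible
  ... | false = atom-impossible
  ... | true = ∉-backwards (U-mono₂ (tautology (! (x₀ & x₁) ⊃ (! (x₀ & ! x₁) ⊃ ! x₀)) (approx n ∷ atom n ∷ []))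
                                    atom-impossible)
                           (approx-possible n)

  approx-consistent : ∀ n → ¬ (U (~ approx n) ∈ Γ)
  approx-consistent n impossible with () ← trans (sym impossible) (approx-possible n)

  approx-weaken : ∀ {m N} → m ≤′ N → ⊢ approx N ⇒ approx m
  approx-weaken {m} ≤′-refl = tautology (x₀ ⊃ x₀) (approx m ∷ [])
  approx-weaken {N = suc N} (≤′-step m≤N) =
    syllogism (tautology ((x₀ & x₁) ⊃ x₀) (approx N ∷ signed (valuation (atom N)) (atom N) ∷ []))
              (approx-weaken m≤N)

  approx-decides : ∀ α N → letter-bound α ≤ N → U (approx N ⇒ signed (eval valuation α) α) ∈ Γ
  approx-decides (atom n) N n<N = nec∈ (syllogism (approx-weaken (≤⇒≤′ n<N))
    (tautology ((x₀ & x₁) ⊃ x₁) (approx n ∷ signed (valuation (atom n)) (atom n) ∷ [])))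
  approx-decides (~ α) N α≤N rewrite eval-~ valuation α =
    U-lift₁ (signed-~ (eval valuation α) α) (approx-decides α N α≤N)
  approx-decides (α ∧ β) N αβ≤N rewrite eval-∧ valuation α β =
    U-lift₂ (signed-∧ (eval valuation α) (eval valuation β) α β)
            (approx-decides α N (m⊔n≤o⇒m≤o (letter-bound α) (letter-bound β) αβ≤N))
            (approx-decides β N (m⊔n≤o⇒n≤o (letter-bound α) (letter-bound β) αβ≤N))
  approx-decides (Khm a c b) N _ with Γ (Khm a c b) in k
  ... | true = U-mono (tautology (x₀ ⊃ (x₁ ⊃ x₀)) (Khm a c b ∷ approx N ∷ [])) (Khm-4 k)
  ... | false = U-mono (tautology (x₀ ⊃ (x₁ ⊃ x₀)) (~ Khm a c b ∷ approx N ∷ [])) (Khm-5 (neg∈ k))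

  conj-true : ∀ l → All (_∈ Δ) l → conj l ∈ Δ
  conj-true [] [] = instance-taut (⊤ˢ x₀) tt (atom 0 ∷ []) valuation
  conj-true (φ ∷ l) (φ∈Δ ∷ l⊆Δ) = trans (eval-∧ valuation φ (conj l)) (both φ∈Δ (conj-true l l⊆Δ))
    where
    both : ∀ {b c} → b ≡ true → c ≡ true → (b && c) ≡ true
    both refl refl = refl

  Δ-consistent : Consistent (_∈ Δ)
  Δ-consistent (l , l⊆Δ , ⊢¬l) = approx-consistent N
    (U-mono₂ (tautology ((x₀ ⊃ x₁) ⊃ (! x₁ ⊃ ! x₀)) (approx N ∷ conj l ∷ []))
             (≡-subst (λ b → U (approx N ⇒ signed b (conj l)) ∈ Γ) (conj-true l l⊆Δ) (approx-decides (conj l) N ≤-refl))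
             (nec∈ ⊢¬l))
    where
    N : ℕ
    N = letter-bound (conj l)

  -- Δ is a complete valuation, so adding a non-member φ adds a contradiction with ¬φ
  Δ-maximal : ∀ φ → Δ φ ≡ false → ¬ Consistent (λ ψ → ψ ∈ Δ ⊎ ψ ≡ φ)
  Δ-maximal φ φ∉Δ consistent = consistent
    (~ φ ∷ φ ∷ [] , inj₁ (trans (eval-~ valuation φ) (cong not φ∉Δ)) ∷ inj₂ refl ∷ [] ,
     tautology (! (! x₀ & (x₀ & ⊤ˢ x₁))) (φ ∷ atom 0 ∷ []))

  θ∈Δ : θ ∈ Δ
  θ∈Δ with eval valuation θ in θ-value
  ... | true = refl
  ... | false = ⊥-elim (approx-consistent N
    (U-mono₂ (tautology ((x₀ ⊃ ! x₁) ⊃ ((x₀ ⊃ x₁) ⊃ ! x₀)) (approx N ∷ θ ∷ []))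
             (≡-subst (λ b → U (approx N ⇒ signed b θ) ∈ Γ) θ-value (approx-decides θ N ≤-refl))
             (nec∈ (approx-weaken (≤⇒≤′ (z≤n {N}))))))
    where
    N : ℕ
    N = letter-bound θ

extend : (Γ : FSet) → MCS Γ → ∀ θ → Γ (U (~ θ)) ≡ false →
  Σ FSet λ Δ → MCS Δ × (∀ a c b → Δ (Khm a c b) ≡ Γ (Khm a c b)) × θ ∈ Δ
extend Γ mΓ θ θ-possible = Δ , (Δ-consistent , Δ-maximal) , (λ a c b → refl) , θ∈Δ
  where open Extension Γ mΓ θ θ-possible

module Plans (M : Model) where
  open Model M
  open Semantics M

  Achieves : (S → Set) → (S → Set) → List Act → S → Set
  Achieves X Y σ s = StrongExec X σ s × (∀ t → Path σ s t → Y t)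

  -- a state from which the remaining plan σ continues is an intermediate one,
  -- hence must satisfy X, exactly when σ is nonempty
  Intermediate : (S → Set) → List Act → S → Set
  Intermediate X [] s = ⊤
  Intermediate X (_ ∷ _) s = X s

  module _ {X : S → Set} where

    exec-head : ∀ {a σ s} → StrongExec X (a ∷ σ) s → ∃ (Rel a s)
    exec-head exec = proj₁ (exec 0 (s≤s z≤n) _ nil)

    exec-tail : ∀ {a σ s u} → StrongExec X (a ∷ σ) s → Rel a s u → StrongExec X σ u
    exec-tail exec r k k<n t path =
      proj₁ (exec (suc k) (s≤s k<n) t (cons r path)) , λ _ → proj₂ (exec (suc k) (s≤s k<n) t (cons r path)) (s≤s z≤n)

    exec-intermediate : ∀ {a σ s u} → StrongExec X (a ∷ σ) s → Rel a s u → Intermediate X σ u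
    exec-intermediate {σ = []} exec r = tt
    exec-intermediate {σ = _ ∷ _} exec r = proj₂ (exec 1 (s≤s (s≤s z≤n)) _ (cons r nil)) (s≤s z≤n)

    achieves-step : ∀ {Y a σ s u} → Achieves X Y (a ∷ σ) s → Rel a s u →
      Achieves X Y σ u × Intermediate X σ u
    achieves-step (exec , outcome) r =
      (exec-tail exec r , λ t path → outcome t (cons r path)) , exec-intermediate exec r

    exec-one : ∀ {a s} → ∃ (Rel a s) → StrongExec X (a ∷ []) s
    exec-one first zero _ _ nil = first , λ ()
    exec-one first (suc k) (s≤s ()) _ _

    exec-two : ∀ {a b s} → ∃ (Rel a s) → (∀ {u} → Rel a s u → X u × ∃ (Rel b u)) →
      StrongExec X (a ∷ b ∷ []) s
    exec-two first second zero _ _ nil = first , λ ()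
    exec-two first second (suc zero) _ _ (cons r nil) = proj₂ (second r) , λ _ → proj₁ (second r)
    exec-two first second (suc (suc k)) (s≤s (s≤s ())) _ _

module Canonical (Γ : FSet) (mΓ : MCS Γ) where
  open KhmTheory Γ mΓ
  open Semantics (CanModel Γ)
  open Plans (CanModel Γ)
  module At (s : CState Γ) = KhmTheory (L s) (mcs s)

  Khm-from : ∀ (s : CState Γ) {a c b} → Khm a c b ∈ L s → Khm a c b ∈ Γ
  Khm-from s {a} {c} {b} k = trans (sym (same s a c b)) k

  Khm-to : ∀ (s : CState Γ) {a c b} → Khm a c b ∈ Γ → Khm a c b ∈ L s
  Khm-to s {a} {c} {b} k = trans (same s a c b) k

  -- by TU, U-formulas of Γ hold at every state
  U-everywhere : ∀ (s : CState Γ) {a} → U a ∈ Γ → a ∈ L s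
  U-everywhere s Ua = At.U-T s (Khm-to s Ua)

  Legal : Formula → Formula → Set
  Legal χ ψ = (∃ λ φ → InΣ Γ (mrk χ ψ φ)) ⊎ InΣ Γ (emp ψ χ)

  Marked : Formula → Formula → CState Γ → Set
  Marked χ ψ s = (mχ s ≡ χ) × (mψ s ≡ ψ)

  realise : ∀ {χ ψ} → Legal χ ψ → ∀ θ → ⊢ θ ⇒ χ →
    U (~ θ) ∈ Γ ⊎ Σ (CState Γ) λ s → Marked χ ψ s × θ ∈ L s
  realise {χ} {ψ} legal θ θ⇒χ with Γ (U (~ θ)) in θ-status
  ... | true = inj₁ refl
  ... | false with extend Γ mΓ θ θ-status
  ...   | Δ , mcsΔ , sameΔ , θ∈Δ = inj₂ (state , (refl , refl) , θ∈Δ)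
    where
    state : CState Γ
    state = record { L = Δ ; mcs = mcsΔ ; same = sameΔ ; mχ = χ ; mψ = ψ
                   ; χ∈L = KhmTheory.imp∈ Δ mcsΔ θ⇒χ θ∈Δ ; ok = legal }

  -- every m^m is a legal marker, as Khm m ⊥ m follows from EMPKhm
  realise-at : ∀ {m} → ⊢ m → ∀ θ → U (~ θ) ∈ Γ ⊎ Σ (CState Γ) λ s → Marked m m s × θ ∈ L s
  realise-at {m} ⊢m θ =
    Sum.map (U-mono₂ (tautology (x₀ ⊃ (! (x₀ & x₁) ⊃ ! x₁)) (m ∷ θ ∷ [])) (nec∈ ⊢m))
            (λ (s , marked , mθ) → s , marked , At.∧-elimʳ s mθ)
            (realise (inj₂ (EMP∈ U-refl)) (m ∧ θ) (tautology ((x₀ & x₁) ⊃ x₀) (m ∷ θ ∷ [])))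

  somewhere : ∀ θ → U (~ θ) ∈ Γ ⊎ Σ (CState Γ) λ s → θ ∈ L s
  somewhere θ = Sum.map₂ (λ (s , _ , θs) → s , θs) (realise-at (tautology (⊤ˢ x₀) (atom 0 ∷ [])) θ)

  -- a possible θ holds at two states with different markers (⊤f and ¬¬⊤f)
  markers-vary : ∀ θ → U (~ θ) ∈ Γ ⊎
    Σ (CState Γ) λ s → Σ (CState Γ) λ s' → θ ∈ L s × θ ∈ L s' × ¬ (mχ s ≡ mχ s')
  markers-vary θ =
    Sum.[ inj₁ , (λ (s , (⊤-marker , _) , θs) →
      Sum.map₂ (λ (s' , (¬¬⊤-marker , _) , θs') →
                  s , s' , θs , θs' , λ equal → distinct (trans (sym ⊤-marker) (trans equal ¬¬⊤-marker)))
               (realise-at (tautology (! ! ⊤ˢ x₀) (atom 0 ∷ [])) θ)) ]′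
    (realise-at (tautology (⊤ˢ x₀) (atom 0 ∷ [])) θ)
    where
    distinct : ¬ (⊤f ≡ ~ ~ ⊤f)
    distinct ()

  U-from-states : ∀ {a b} → (∀ s → a ∈ L s → b ∈ L s) → U (a ⇒ b) ∈ Γ
  U-from-states {a} {b} a→b =
    Sum.[ id , (λ (s , a¬b) → ⊥-elim (At.not-both s (a→b s (At.∧-elimˡ s a¬b)) (At.∧-elimʳ s a¬b))) ]′
    (somewhere (a ∧ ~ b))

  U-from-marked : ∀ {χ ψ b} → Legal χ ψ → (∀ s → Marked χ ψ s → b ∈ L s) → U (χ ⇒ b) ∈ Γ
  U-from-marked {χ} {ψ} {b} legal marked→b =
    Sum.[ id , (λ (s , marked , χ¬b) → ⊥-elim (At.not-both s (marked→b s marked) (At.∧-elimʳ s χ¬b))) ]′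
    (realise legal (χ ∧ ~ b) (tautology ((x₀ & x₁) ⊃ x₀) (χ ∷ ~ b ∷ [])))

  goal-possible : ∀ {ψ c φ} (s : CState Γ) → Khm ψ c φ ∈ Γ → ψ ∈ L s → ¬ (U (~ φ) ∈ Γ)
  goal-possible s k ψs U¬φ = At.not-both s ψs (U-everywhere s (Khm-impossible-goal k U¬φ))

  emp-step : ∀ {ψ φ} (l : Khm ψ ⊥f φ ∈ Γ) s → ψ ∈ L s → ∃ (CRel Γ (emp ψ φ , l) s)
  emp-step {ψ} {φ} l s ψs =
    Sum.[ ⊥-elim ∘ goal-possible s l ψs , (λ (u , marked , _) → u , ψs , marked) ]′
    (realise (inj₂ l) φ (tautology (x₀ ⊃ x₀) (φ ∷ [])))

  marker-holds : ∀ {χ} (t : CState Γ) → mχ t ≡ χ → χ ∈ L t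
  marker-holds t χ-marker = ≡-subst (_∈ L t) χ-marker (χ∈L t)

  mrk-step : ∀ {χ ψ φ} (l : InΣ Γ (mrk χ ψ φ)) → ¬ (U (~ φ) ∈ Γ) →
    ∀ u → Marked χ ψ u → ∃ (CRel Γ (mrk χ ψ φ , l) u)
  mrk-step {φ = φ} l φ-possible u marked =
    Sum.[ ⊥-elim ∘ φ-possible , (λ (v , φv) → v , marked , φv) ]′ (somewhere φ)

  -- Khm ψ χ φ ∈ Γ is witnessed by ⟨ψ,⊥,φ⟩ or, failing Khm ψ ⊥ φ, by ⟨ψ,⊥,χ⟩⟨χ^ψ,φ⟩
  Khm⇒plan : ∀ {ψ χ φ} → (∀ t → t ⊨ ψ → ψ ∈ L t) → (∀ t → χ ∈ L t → t ⊨ χ) → (∀ t → φ ∈ L t → t ⊨ φ) →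
    Khm ψ χ φ ∈ Γ → ∀ w → w ⊨ Khm ψ χ φ
  Khm⇒plan {ψ} {χ} {φ} ψ-sound χ-complete φ-complete k w = Sum.[ one-step , two-step ]′ (decide (Khm ψ ⊥f φ))
    where
    one-step : Khm ψ ⊥f φ ∈ Γ → w ⊨ Khm ψ χ φ
    one-step k⊥ = (emp ψ φ , k⊥) ∷ [] , λ s ψ-holds →
      exec-one (emp-step k⊥ s (ψ-sound s ψ-holds)) ,
      λ { t (cons r nil) → φ-complete t (marker-holds t (proj₁ (proj₂ r))) }
    two-step : (~ Khm ψ ⊥f φ) ∈ Γ → w ⊨ Khm ψ χ φ
    two-step ¬k⊥ = (emp ψ χ , ONE∈ k ¬k⊥) ∷ (mrk χ ψ φ , (k , ¬k⊥)) ∷ [] , λ s ψ-holds →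
      exec-two (emp-step (ONE∈ k ¬k⊥) s (ψ-sound s ψ-holds))
               (λ {u} r → χ-complete u (marker-holds u (proj₁ (proj₂ r))) ,
                      mrk-step (k , ¬k⊥) (goal-possible s k (ψ-sound s ψ-holds)) u (proj₂ r)) ,
      λ { t (cons _ (cons (_ , φt) nil)) → φ-complete t φt }

  module PlanToKhm (χ φ : Formula) (χ-sound : ∀ t → t ⊨ χ → χ ∈ L t) (φ-sound : ∀ t → t ⊨ φ → φ ∈ L t) where

    Works : List (ΣΓ Γ) → CState Γ → Set
    Works = Achieves (_⊨ χ) (_⊨ φ)

    Continues : List (ΣΓ Γ) → CState Γ → Set
    Continues σ s = Works σ s × Intermediate (_⊨ χ) σ s

    reaches-goal : ∀ {s} → Works [] s → φ ∈ L s
    reaches-goal {s} (_ , outcome) = φ-sound s (outcome s nil)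

    mutual
      plan⇒Khm : ∀ θ σ → (∀ s → θ ∈ L s → Works σ s) → Khm θ χ φ ∈ Γ
      plan⇒Khm θ [] works = Khm-emp (U-from-states λ s θs → reaches-goal (works s θs))
      -- a marker action cannot start the plan: θ-states carry different markers
      plan⇒Khm θ ((mrk χ₂ ψ₂ φ₂ , l) ∷ σ) works =
        Sum.[ Khm-vacuous , (λ (s , s' , θs , θs' , differ) →
                ⊥-elim (differ (trans (first-marker (works s θs)) (sym (first-marker (works s' θs')))))) ]′
        (markers-vary θ)
        where
        first-marker : ∀ {t} → Works ((mrk χ₂ ψ₂ φ₂ , l) ∷ σ) t → mχ t ≡ χ₂
        first-marker (exec , _) = proj₁ (proj₁ (proj₂ (exec-head exec)))
      plan⇒Khm θ ((emp ψ₁ φ₁ , l) ∷ σ) works =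
        Sum.[ Khm-vacuous , (λ (s₀ , θs₀) →
                UKhm∈ (U-from-states λ s θs → proj₁ (proj₂ (exec-head (proj₁ (works s θs)))))
                      U-refl U-refl (after-emp l σ (works s₀ θs₀))) ]′
        (somewhere θ)

      -- after ⟨ψ,⊥,χ'⟩ the plan continues from every state marked χ'^ψ
      after-emp : ∀ {ψ χ'} (l : Khm ψ ⊥f χ' ∈ Γ) σ {s₀} → Works ((emp ψ χ' , l) ∷ σ) s₀ → Khm ψ χ φ ∈ Γ
      after-emp l σ works@(exec , _) =
        marked-plan⇒Khm l σ λ s marked → achieves-step works (proj₁ (proj₂ (exec-head exec)) , marked)

      -- given Khm ψ ⊥ χ', a plan continuing from all χ'^ψ-marked states yields Khm ψ χ φ;
      -- without such states U¬χ' ∈ Γ and Khm ψ ⊥ χ' already suffices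
      marked-plan⇒Khm : ∀ {ψ χ'} → Khm ψ ⊥f χ' ∈ Γ → ∀ σ →
        (∀ s → Marked χ' ψ s → Continues σ s) → Khm ψ χ φ ∈ Γ
      marked-plan⇒Khm l [] continues =
        Khm-via l (U-from-marked (inj₂ l) λ s marked → reaches-goal (proj₁ (continues s marked)))
      marked-plan⇒Khm {ψ} {χ'} l (a ∷ σ) continues =
        Sum.[ Khm-via l ∘ U-vacuous , (λ (s₀ , marked₀ , _) →
                marked-step l (U-from-marked (inj₂ l) λ s marked → χ-sound s (proj₂ (continues s marked)))
                            a σ (λ s → proj₁ ∘ continues s) s₀ marked₀) ]′
        (realise (inj₂ l) χ' (tautology (x₀ ⊃ x₀) (χ' ∷ [])))

      marked-step : ∀ {ψ χ'} → Khm ψ ⊥f χ' ∈ Γ → U (χ' ⇒ χ) ∈ Γ → ∀ a σ →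
        (∀ s → Marked χ' ψ s → Works (a ∷ σ) s) → ∀ s₀ → Marked χ' ψ s₀ → Khm ψ χ φ ∈ Γ
      marked-step {ψ} {χ'} l χ'⇒χ (emp ψ₂ φ₂ , l₂) σ works s₀ marked₀ =
        COMP∈ (Khm-widen l) (UKhm∈ χ'⇒ψ₂ U-refl U-refl (after-emp l₂ σ (works s₀ marked₀))) χ'⇒χ
        where
        χ'⇒ψ₂ : U (χ' ⇒ ψ₂) ∈ Γ
        χ'⇒ψ₂ = U-from-marked (inj₂ l) λ s marked → proj₁ (proj₂ (exec-head (proj₁ (works s marked))))
      marked-step {ψ} {χ'} l χ'⇒χ (mrk χ₂ ψ₂ φ₂ , (k , _)) σ works s₀ (χ'-marker , ψ-marker) =
        after-mrk σ (λ s φ₂s → achieves-step (works s₀ (χ'-marker , ψ-marker)) (marker₀ , φ₂s))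
                  (UKhm∈ U-refl χ'⇒χ U-refl k')
        where
        marker₀ : Marked χ₂ ψ₂ s₀
        marker₀ = proj₁ (proj₂ (exec-head (proj₁ (works s₀ (χ'-marker , ψ-marker)))))
        k' : Khm ψ χ' φ₂ ∈ Γ
        k' = subst₂ (λ c a → Khm a c φ₂ ∈ Γ)
                    (trans (sym (proj₁ marker₀)) χ'-marker) (trans (sym (proj₂ marker₀)) ψ-marker) k

      after-mrk : ∀ {ψ φ₂} σ → (∀ s → φ₂ ∈ L s → Continues σ s) → Khm ψ χ φ₂ ∈ Γ → Khm ψ χ φ ∈ Γ
      after-mrk [] continues k =
        UKhm∈ U-refl U-refl (U-from-states λ s φ₂s → reaches-goal (proj₁ (continues s φ₂s))) k
      after-mrk {φ₂ = φ₂} σ@(_ ∷ _) continues k =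
        COMP∈ k (plan⇒Khm φ₂ σ λ s → proj₁ ∘ continues s)
                (U-from-states λ s φ₂s → χ-sound s (proj₂ (continues s φ₂s)))

  -- truth lemma, by induction on the formula; the Khm case uses both directions
  -- for the subformulas through plan⇒Khm and Khm⇒plan
  truth-lemma : ∀ φ w → (w ⊨ φ → φ ∈ L w) × (φ ∈ L w → w ⊨ φ)
  truth-lemma (atom n) w = id , id
  truth-lemma (~ φ) w = sound , complete
    where
    sound : ¬ (w ⊨ φ) → (~ φ) ∈ L w
    sound φ-fails = Sum.[ ⊥-elim ∘ φ-fails ∘ proj₂ (truth-lemma φ w) , id ]′ (At.decide w φ)
    complete : (~ φ) ∈ L w → ¬ (w ⊨ φ)
    complete ¬φ∈ φ-holds = At.not-both w (proj₁ (truth-lemma φ w) φ-holds) ¬φ∈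
  truth-lemma (φ ∧ ψ) w =
    (λ (φ-holds , ψ-holds) → At.∧-intro w (proj₁ (truth-lemma φ w) φ-holds) (proj₁ (truth-lemma ψ w) ψ-holds)) ,
    (λ φψ∈ → proj₂ (truth-lemma φ w) (At.∧-elimˡ w φψ∈) , proj₂ (truth-lemma ψ w) (At.∧-elimʳ w φψ∈))
  truth-lemma (Khm ψ χ φ) w =
    (λ (σ , works) → Khm-to w (plan⇒Khm ψ σ λ s ψs → works s (proj₂ (truth-lemma ψ s) ψs))) ,
    (λ k → Khm⇒plan (λ t → proj₁ (truth-lemma ψ t)) (λ t → proj₂ (truth-lemma χ t))
                    (λ t → proj₂ (truth-lemma φ t)) (Khm-from w k) w)
    where open PlanToKhm χ φ (λ t → proj₁ (truth-lemma χ t)) (λ t → proj₁ (truth-lemma φ t))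

lemma1 : (Γ : FSet) → MCS Γ → (φ : Formula) → (w : CState Γ) →
    (Γ , w ⊨c φ) ⇔ (L w φ ≡ true)
lemma1 Γ mΓ φ w = mk⇔ (proj₁ (truth-lemma φ w)) (proj₂ (truth-lemma φ w))
  where open Canonical Γ mΓ
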